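{- Let $k\in\mathbb{N}$ and let $w$ be a word that is $k$-local witnessed by the marking sequence $s=(s[1],\dots,s[|s|])$. Let $i\in\{1,\dots,|s|\}$ and $\mathtt a=s[i]$. For every $j\in\{0,\dots,|s|\}$ let $u_j=\pi_{\{s[1],\dots,s[j]\}}(w)$ and let $w_j$ be the marked version of $w$ at stage $j$ with respect to $s$. Suppose $E$ is a $\Sigma_k$-expression for $\mathcal{G}(u_{i-1})$ in which every node $v$ has label $\mathrm{lab}^k_{w_{i-1}}(v)$. Then there is a $\Sigma_k$-expression for $\mathcal{G}(u_i)$ in which every node $v$ has label $\mathrm{lab}^k_{w_i}(v)$.
   Context: For $S\subseteq\Sigma$, $\pi_S$ is the morphism erasing letters not in $S$ and keeping letters of $S$. Two distinct letters alternate in a word if deleting all other letters yields an alternating word ($(\mathtt{ab})^n$, $(\mathtt{ab})^n\mathtt a$, $(\mathtt{ba})^n$ or $(\mathtt{ba})^n\mathtt b$, $n\ge1$). $\mathcal G(u)$ is the graph whose nodes are the letters of $u$ and whose edges are the pairs of letters alternating in $u$. A marking sequence for $w$ is an enumeration of the distinct letters of $w$; the marked version $w_j$ at stage $j$ marks every occurrence of $s[1],\dots,s[j]$; a (marked) block is a maximal factor of consecutive marked positions; $w$ is $k$-local witnessed by $s$ if every $w_j$ has at most $k$ blocks. Labelled-graph operations: $\ell(v)$ creates a node $v$ with label $\ell$; $G\oplus H$ is disjoint union; $\eta_{\ell,\ell'}$ ($\ell\ne\ell'$) adds all edges between nodes labelled $\ell$ and nodes labelled $\ell'$; $\rho_{\ell\to\ell'}$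 relabels $\ell$ to $\ell'$. For a set $M$, an $M$-expression is an expression built from these operations using only labels from $M$; it is an expression for a graph if it produces a labelled version of that graph. $\Sigma_k=\{0,1\}^k\cup\{2\}$. For a marked word $m$ and a letter $\mathtt a$, $\mathrm{lab}^k_m(\mathtt a)\in\Sigma_k$ is defined as follows: if some block of $m$ contains two or more occurrences of $\mathtt a$ then $\mathrm{lab}^k_m(\mathtt a)=2$; otherwise it is the $k$-tuple whose $t$-th component is $1$ if there is one occurrence of $\mathtt a$ in the $t$-th block of $m$, and $0$ if $m$ has fewer than $t$ blocks or the $t$-th block contains no occurrence of $\mathtt a$. -}

module Defs where

open import Data.Nat using (ℕ; zero; suc; _≤_; _≟_)
open import Data.Bool using (Bool; true; false)
open import Data.List using (List; []; _∷_; filter; map; take; length; concat; replicate; _++_)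
open import Data.List.Membership.Propositional using (_∈_)
open import Data.List.Membership.DecPropositional _≟_ using (_∈?_)
open import Data.List.Relation.Unary.Unique.Propositional using (Unique)
open import Data.Vec using (Vec; []; _∷_)
open import Data.Product using (Σ; ∃; _×_; _,_)
open import Data.Sum using (_⊎_)
open import Data.Empty using (⊥)
open import Relation.Nullary using (¬_; does)
open import Relation.Binary.PropositionalEquality using (_≡_; _≢_)
open import Function.Bundles using (_⇔_)

Letter : Set
Letter = ℕ

Word : Set
Word = List Letter

π : List Letter → Word → Word
π S w = filter (λ x → x ∈? S) w

pow : ℕ → Word → Word
pow n xs = concat (replicate n xs)

AlternatingWord : Letter → Letter → Word → Set
AlternatingWord a b u = Σ ℕ λ n → 1 ≤ n ×
  ( (u ≡ pow n (a ∷ b ∷ [])) ⊎ (u ≡ pow n (a ∷ b ∷ []) ++ (a ∷ []))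
  ⊎ (u ≡ pow n (b ∷ a ∷ [])) ⊎ (u ≡ pow n (b ∷ a ∷ []) ++ (b ∷ [])))

Alternate : Word → Letter → Letter → Set
Alternate u a b = a ≢ b × AlternatingWord a b (π (a ∷ b ∷ []) u)

record Graph : Set₁ where
  field
    Node : Letter → Set
    Adj  : Letter → Letter → Set

AltGraph : Word → Graph
AltGraph u = record { Node = λ x → x ∈ u ; Adj = λ x y → x ∈ u × y ∈ u × Alternate u x y }

MarkingSequence : Word → List Letter → Set
MarkingSequence w s = Unique s × (∀ x → (x ∈ s) ⇔ (x ∈ w))

-- A marked word: each position carries its letter and whether it is marked.
MarkedWord : Set
MarkedWord = List (Letter × Bool)

markedAt : List Letter → ℕ → Word → MarkedWord
markedAt s j w = map (λ x → x , does (x ∈? take j s)) w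

consNE : Word → List Word → List Word
consNE [] bs = bs
consNE (x ∷ c) bs = (x ∷ c) ∷ bs

-- leading (possibly empty) marked run, and the blocks after it
blocksAux : MarkedWord → Word × List Word
blocksAux [] = [] , []
blocksAux ((x , true) ∷ r) with blocksAux r
... | c , bs = (x ∷ c) , bs
blocksAux ((x , false) ∷ r) with blocksAux r
... | c , bs = [] , consNE c bs

blocks : MarkedWord → List Word
blocks m with blocksAux m
... | c , bs = consNE c bs

KLocalWitnessed : ℕ → Word → List Letter → Set
KLocalWitnessed k w s = MarkingSequence w s ×
  (∀ j → j ≤ length s → length (blocks (markedAt s j w)) ≤ k)

data Lab (k : ℕ) : Set where
  tup : Vec Bool k → Lab k
  two : Lab k

occ : Letter → Word → ℕ
occ a [] = 0
occ a (x ∷ r) with a ≟ x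
... | Relation.Nullary.yes _ = suc (occ a r)
... | Relation.Nullary.no _ = occ a r

SomeBlockTwice : Letter → List Word → Set
SomeBlockTwice a bs = Σ Word λ b → b ∈ bs × 2 ≤ occ a b

isOne : ℕ → Bool
isOne (suc zero) = true
isOne _ = false

tupleOf : (k : ℕ) → Letter → List Word → Vec Bool k
tupleOf zero a bs = []
tupleOf (suc k) a [] = false ∷ tupleOf k a []
tupleOf (suc k) a (b ∷ bs) = isOne (occ a b) ∷ tupleOf k a bs

-- lab^k_m(a) as a relation (the case distinction is on a proposition)
data HasLab (k : ℕ) (m : MarkedWord) (a : Letter) : Lab k → Set where
  isTwo : SomeBlockTwice a (blocks m) → HasLab k m a two
  isTup : ¬ SomeBlockTwice a (blocks m) → HasLab k m a (tup (tupleOf k a (blocks m)))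

data Expr (k : ℕ) : Set where
  node : Lab k → Letter → Expr k
  _⊕_  : Expr k → Expr k → Expr k
  η    : (ℓ ℓ' : Lab k) → ℓ ≢ ℓ' → Expr k → Expr k
  ρ    : Lab k → Lab k → Expr k → Expr k

data _∋_∶_ {k : ℕ} : Expr k → Letter → Lab k → Set where
  n-node : ∀ {ℓ v} → node ℓ v ∋ v ∶ ℓ
  n-⊕ˡ   : ∀ {E F v ℓ} → E ∋ v ∶ ℓ → (E ⊕ F) ∋ v ∶ ℓ
  n-⊕ʳ   : ∀ {E F v ℓ} → F ∋ v ∶ ℓ → (E ⊕ F) ∋ v ∶ ℓ
  n-η    : ∀ {ℓ₁ ℓ₂ p E v ℓ} → E ∋ v ∶ ℓ → η ℓ₁ ℓ₂ p E ∋ v ∶ ℓ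
  n-ρ≡   : ∀ {ℓ₁ ℓ₂ E v} → E ∋ v ∶ ℓ₁ → ρ ℓ₁ ℓ₂ E ∋ v ∶ ℓ₂
  n-ρ≢   : ∀ {ℓ₁ ℓ₂ E v ℓ} → E ∋ v ∶ ℓ → ℓ ≢ ℓ₁ → ρ ℓ₁ ℓ₂ E ∋ v ∶ ℓ

-- edges of the graph produced by E (undirected: η adds both directions)
data Edge {k : ℕ} : Expr k → Letter → Letter → Set where
  e-⊕ˡ : ∀ {E F x y} → Edge E x y → Edge (E ⊕ F) x y
  e-⊕ʳ : ∀ {E F x y} → Edge F x y → Edge (E ⊕ F) x y
  e-η  : ∀ {ℓ₁ ℓ₂ p E x y} → Edge E x y → Edge (η ℓ₁ ℓ₂ p E) x y
  e-new₁ : ∀ {ℓ₁ ℓ₂ p E x y} → E ∋ x ∶ ℓ₁ → E ∋ y ∶ ℓ₂ → Edge (η ℓ₁ ℓ₂ p E) x y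
  e-new₂ : ∀ {ℓ₁ ℓ₂ p E x y} → E ∋ x ∶ ℓ₂ → E ∋ y ∶ ℓ₁ → Edge (η ℓ₁ ℓ₂ p E) x y
  e-ρ  : ∀ {ℓ₁ ℓ₂ E x y} → Edge E x y → Edge (ρ ℓ₁ ℓ₂ E) x y

HasNode : ∀ {k} → Expr k → Letter → Set
HasNode E v = ∃ λ ℓ → E ∋ v ∶ ℓ

data WF {k : ℕ} : Expr k → Set where
  wf-node : ∀ {ℓ v} → WF (node ℓ v)
  wf-⊕ : ∀ {E F} → WF E → WF F → (∀ v → HasNode E v → ¬ HasNode F v) → WF (E ⊕ F)
  wf-η : ∀ {ℓ₁ ℓ₂ p E} → WF E → WF (η ℓ₁ ℓ₂ p E)
  wf-ρ : ∀ {ℓ₁ ℓ₂ E} → WF E → WF (ρ ℓ₁ ℓ₂ E)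

ExprFor : ∀ {k} → Expr k → Graph → Set
ExprFor E G = WF E × (∀ v → HasNode E v ⇔ Graph.Node G v)
                   × (∀ x y → Edge E x y ⇔ Graph.Adj G x y)

LabelledBy : ∀ {k} → Expr k → MarkedWord → Set
LabelledBy {k} E m = ∀ v ℓ → E ∋ v ∶ ℓ → HasLab k m v ℓ

-- A new node a labelled 0ᵏ is added to E; no old node carries 0ᵏ, since every old letter has a marked
-- occurrence.  The old label of an old letter x determines both its new label and whether x alternates
-- with a.  If it is 2, some block contains x twice; marking a only merges blocks, so the new label is 2
-- as well, and π_{x,a}(u_i) contains xx, so x does not alternate with a.  Otherwise, as there are at most
-- k blocks, the label records how often x occurs in each block; the blocks and the unmarked occurrences
-- of a being the same for every x, this count sequence determines the new counts of x and, up to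
-- renaming x, the word π_{x,a}(u_i).  Hence one η between 0ᵏ and the old labels of the letters that
-- alternate with a adds exactly the new edges, and relabelling by a function on Σ_k (collapsing label
-- classes with ρ, then renaming injectively) installs the new labels.

module Submission where

open import Defs
open import Data.Bool using (Bool; true; false)
import Data.Bool.Properties as Bool
open import Data.Fin using (Fin; fromℕ<)
open import Data.Fin.Properties using (toℕ-fromℕ<)
open import Data.List
  using (List; []; _∷_; _++_; _∷ʳ_; [_]; length; map; concat; replicate; filter; head; foldr; take; lookup)
import Data.List.Properties as List
open import Data.List.Membership.Propositional using (_∈_; _∉_; find; lose)
open import Data.List.Membership.Propositional.Properties
  using (∈-map⁺; ∈-map⁻; ∈-++⁺ˡ; ∈-++⁺ʳ; ∈-++⁻; ∈-filter⁺; ∈-filter⁻; ∈-lookup)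
import Data.List.Relation.Unary.All as All
open import Data.List.Relation.Unary.AllPairs using (_∷_)
open import Data.List.Relation.Unary.Any using (Any; here; there; any?)
import Data.List.Relation.Unary.Any.Properties as Any
open import Data.List.Relation.Unary.Linked as Linked using (Linked; []; [-]; _∷_; _∷′_)
open import Data.List.Relation.Unary.Unique.Propositional using (Unique)
import Data.List.Relation.Unary.Unique.Propositional.Properties as Unique
open import Data.Maybe using (just)
open import Data.Maybe.Relation.Binary.Connected using (Connected; just; just-nothing)
open import Data.Nat using (ℕ; zero; suc; _+_; _∸_; _≤_; _<_; z≤n; s≤s; _≟_; _≤?_)
open import Data.Nat.Properties using (<⇒≤; ≤-trans; m≤m+n; m≤n+m; anyUpTo?; ≰⇒>; suc-injective; module ≤-Reasoning)
open import Data.Product using (∃; _×_; _,_; proj₁; proj₂; uncurry)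
open import Data.Sum using (_⊎_; inj₁; inj₂; fromInj₁; fromInj₂; map₂)
open import Data.Vec as Vec using (Vec; []; _∷_)
import Data.Vec.Properties as Vec
open import Function using (_∘_)
open import Function.Bundles using (_⇔_; mk⇔; Equivalence)
open import Function.Definitions using (Injective)
open import Relation.Binary.Definitions using (DecidableEquality)
open import Relation.Binary.PropositionalEquality
  using (_≡_; _≢_; refl; sym; trans; cong; cong₂; subst; subst₂; module ≡-Reasoning)
open import Relation.Nullary using (¬_; ¬?; Dec; yes; no; does; contradiction; _×-dec_; _⊎-dec_; map′)
open import Relation.Nullary.Decidable using (does-⇔; dec-true; dec-false)
open import Relation.Unary using (_⊆_; Decidable)

open import Data.List.Membership.DecPropositional _≟_ using (_∈?_)

private variable
  a b x y : Letter
  S S' : List Letter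

-- Lists and projections

occ-++ : ∀ x (u v : Word) → occ x (u ++ v) ≡ occ x u + occ x v
occ-++ x []      v = refl
occ-++ x (y ∷ u) v with x ≟ y
... | yes _ = cong suc (occ-++ x u v)
... | no  _ = occ-++ x u v

occ-self : ∀ x → occ x [ x ] ≡ 1
occ-self x with x ≟ x
... | yes _   = refl
... | no  x≢x = contradiction refl x≢x

occ-other : x ≢ y → occ x [ y ] ≡ 0
occ-other {x} {y} x≢y with x ≟ y
... | yes x≡y = contradiction x≡y x≢y
... | no  _   = refl

π-∷-∈ : ∀ {w} → y ∈ S → π S (y ∷ w) ≡ y ∷ π S w
π-∷-∈ = List.filter-accept (_∈? _)

π-∷-∉ : ∀ {w} → y ∉ S → π S (y ∷ w) ≡ π S w
π-∷-∉ = List.filter-reject (_∈? _)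

π-∷-cong : ∀ {v v'} → π S v ≡ π S v' → π S (y ∷ v) ≡ π S (y ∷ v')
π-∷-cong {S = S} {y = y} {v} {v'} eq = by-cases (y ∈? S)
  -- A helper rather than with: with would also abstract the test inside the unfolded π.
  where
  by-cases : Dec (y ∈ S) → π S (y ∷ v) ≡ π S (y ∷ v')
  by-cases (yes y∈S) = trans (π-∷-∈ y∈S) (trans (cong (y ∷_) eq) (sym (π-∷-∈ y∈S)))
  by-cases (no  y∉S) = trans (π-∷-∉ y∉S) (trans eq (sym (π-∷-∉ y∉S)))

π-π : (∀ {z} → z ∈ S → z ∈ S') → ∀ w → π S (π S' w) ≡ π S w
π-π S⊆S' [] = refl
π-π {S} {S'} S⊆S' (y ∷ w) = by-cases (y ∈? S')
  where
  by-cases : Dec (y ∈ S') → π S (π S' (y ∷ w)) ≡ π S (y ∷ w)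
  by-cases (yes y∈S') = trans (cong (π S) (π-∷-∈ y∈S')) (π-∷-cong {S = S} (π-π S⊆S' w))
  by-cases (no  y∉S') =
    trans (cong (π S) (π-∷-∉ y∉S')) (trans (π-π S⊆S' w) (sym (π-∷-∉ (y∉S' ∘ S⊆S'))))

pair-swap : ∀ {z} → z ∈ a ∷ b ∷ [] → z ∈ b ∷ a ∷ []
pair-swap (here z≡a)          = there (here z≡a)
pair-swap (there (here z≡b))  = here z≡b
pair-swap (there (there ()))

π-pair-comm : ∀ a b w → π (a ∷ b ∷ []) w ≡ π (b ∷ a ∷ []) w
π-pair-comm a b = List.filter-≐ (_∈? a ∷ b ∷ []) (_∈? b ∷ a ∷ []) (pair-swap , pair-swap)

inS : List Letter → Letter → Bool
inS S y = does (y ∈? S)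

∈-π⁺ : ∀ {v w} → v ∈ w → v ∈ S → v ∈ π S w
∈-π⁺ {S} = ∈-filter⁺ (_∈? S)

∈-π⁻ : ∀ {v} w → v ∈ π S w → v ∈ w × v ∈ S
∈-π⁻ {S} w = ∈-filter⁻ (_∈? S) {xs = w}

Unique-∷ʳ⇒∉ : ∀ xs → Unique (xs ∷ʳ a) → a ∉ xs
Unique-∷ʳ⇒∉ (x ∷ xs) (x≢ ∷ _)      (here refl) = All.lookup x≢ (∈-++⁺ʳ xs (here refl)) refl
Unique-∷ʳ⇒∉ (x ∷ xs) (_ ∷ unique) (there a∈)  = Unique-∷ʳ⇒∉ xs unique a∈

-- Alternating words

AlternatingWordOfPower : Letter → Letter → Word → ℕ → Set
AlternatingWordOfPower a b u n = 1 ≤ n ×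
  ( (u ≡ pow n (a ∷ b ∷ [])) ⊎ (u ≡ pow n (a ∷ b ∷ []) ++ (a ∷ []))
  ⊎ (u ≡ pow n (b ∷ a ∷ [])) ⊎ (u ≡ pow n (b ∷ a ∷ []) ++ (b ∷ [])))

n≤length-pow-++ : ∀ n (x : Letter) xs e → n ≤ length (pow n (x ∷ xs) ++ e)
n≤length-pow-++ zero    x xs e = z≤n
n≤length-pow-++ (suc n) x xs e = s≤s (begin
  n                                      ≤⟨ n≤length-pow-++ n x xs e ⟩
  length (pow n (x ∷ xs) ++ e)           ≤⟨ m≤n+m _ (length xs) ⟩
  length xs + length (pow n (x ∷ xs) ++ e) ≡⟨ List.length-++ xs ⟨
  length (xs ++ pow n (x ∷ xs) ++ e)     ≡⟨ cong length (List.++-assoc xs _ e) ⟨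
  length ((xs ++ pow n (x ∷ xs)) ++ e)   ∎)
  where open ≤-Reasoning

n≤length-pow : ∀ n (x : Letter) xs → n ≤ length (pow n (x ∷ xs))
n≤length-pow n x xs = subst (λ u → n ≤ length u) (List.++-identityʳ (pow n (x ∷ xs))) (n≤length-pow-++ n x xs [])

power≤length : ∀ {a b u n} → AlternatingWordOfPower a b u n → n ≤ length u
power≤length {a} {b} {n = n} (_ , inj₁ refl)                = n≤length-pow n a _
power≤length {a} {b} {n = n} (_ , inj₂ (inj₁ refl))         = n≤length-pow-++ n a _ _
power≤length {a} {b} {n = n} (_ , inj₂ (inj₂ (inj₁ refl)))  = n≤length-pow n b _
power≤length {a} {b} {n = n} (_ , inj₂ (inj₂ (inj₂ refl)))  = n≤length-pow-++ n b _ _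

alternatingWord? : ∀ a b u → Dec (AlternatingWord a b u)
alternatingWord? a b u = map′ (λ (n , _ , p) → n , p) (λ (n , p) → n , s≤s (power≤length p) , p)
  (anyUpTo? power? (suc (length u)))
  where
  _≟w_ : DecidableEquality Word
  _≟w_ = List.≡-dec _≟_
  power? : ∀ n → Dec (AlternatingWordOfPower a b u n)
  power? n = (1 ≤? n) ×-dec (u ≟w _ ⊎-dec u ≟w _ ⊎-dec u ≟w _ ⊎-dec u ≟w _)

alternate? : ∀ u x y → Dec (Alternate u x y)
alternate? u x y = (¬? (x ≟ y)) ×-dec alternatingWord? x y (π (x ∷ y ∷ []) u)

alternatingWord-sym : AlternatingWord a b ⊆ AlternatingWord b a
alternatingWord-sym (n , 1≤n , inj₁ e)                = n , 1≤n , inj₂ (inj₂ (inj₁ e))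
alternatingWord-sym (n , 1≤n , inj₂ (inj₁ e))         = n , 1≤n , inj₂ (inj₂ (inj₂ e))
alternatingWord-sym (n , 1≤n , inj₂ (inj₂ (inj₁ e)))  = n , 1≤n , inj₁ e
alternatingWord-sym (n , 1≤n , inj₂ (inj₂ (inj₂ e)))  = n , 1≤n , inj₂ (inj₁ e)

alternate-sym : ∀ u → Alternate u x y → Alternate u y x
alternate-sym {x} {y} u (x≢y , alt) =
  x≢y ∘ sym , subst (AlternatingWord y x) (π-pair-comm x y u) (alternatingWord-sym alt)

Alternate-π : x ∈ S → y ∈ S → ∀ w → Alternate (π S w) x y ⇔ Alternate w x y
Alternate-π {x} {S} {y} x∈S y∈S w = mk⇔
  (λ (x≢y , alt) → x≢y , subst (AlternatingWord x y) (π-π pair⊆S w) alt)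
  (λ (x≢y , alt) → x≢y , subst (AlternatingWord x y) (sym (π-π pair⊆S w)) alt)
  where
  pair⊆S : ∀ {z} → z ∈ x ∷ y ∷ [] → z ∈ S
  pair⊆S (here refl)         = x∈S
  pair⊆S (there (here refl)) = y∈S

Linked≢-pow-++ : a ≢ b → ∀ n {e} → Connected _≢_ (just b) (head e) → Linked _≢_ e →
                 Linked _≢_ (pow n (a ∷ b ∷ []) ++ e)
Linked≢-pow-++ a≢b zero    b~e e↗ = e↗
Linked≢-pow-++ {a} {b} a≢b (suc n) {e} b~e e↗ = a≢b ∷ (b~rest n ∷′ Linked≢-pow-++ a≢b n b~e e↗)
  where
  b~rest : ∀ m → Connected _≢_ (just b) (head (pow m (a ∷ b ∷ []) ++ e))
  b~rest zero    = b~e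
  b~rest (suc m) = just (a≢b ∘ sym)

Linked≢-pow : a ≢ b → ∀ n → Linked _≢_ (pow n (a ∷ b ∷ []))
Linked≢-pow a≢b n = subst (Linked _≢_) (List.++-identityʳ _) (Linked≢-pow-++ a≢b n just-nothing [])

alternatingWord⇒Linked≢ : a ≢ b → AlternatingWord a b ⊆ Linked _≢_
alternatingWord⇒Linked≢ a≢b (n , _ , inj₁ refl)               = Linked≢-pow a≢b n
alternatingWord⇒Linked≢ a≢b (n , _ , inj₂ (inj₁ refl))        = Linked≢-pow-++ a≢b n (just (a≢b ∘ sym)) [-]
alternatingWord⇒Linked≢ a≢b (n , _ , inj₂ (inj₂ (inj₁ refl))) = Linked≢-pow (a≢b ∘ sym) n
alternatingWord⇒Linked≢ a≢b (n , _ , inj₂ (inj₂ (inj₂ refl))) = Linked≢-pow-++ (a≢b ∘ sym) n (just a≢b) [-]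

¬Linked≢-square : ∀ p q → ¬ Linked _≢_ (p ++ x ∷ x ∷ q)
¬Linked≢-square []      q (x≢x ∷ _) = x≢x refl
¬Linked≢-square (_ ∷ p) q ↗         = ¬Linked≢-square p q (Linked.tail ↗)

map-pow : ∀ (f : Letter → Letter) n u → map f (pow n u) ≡ pow n (map f u)
map-pow f n u = trans (sym (List.concat-map (replicate n u))) (cong concat (List.map-replicate (map f) n u))

alternatingWord-map : ∀ (f : Letter → Letter) {u} → AlternatingWord a b u → AlternatingWord (f a) (f b) (map f u)
alternatingWord-map f (n , 1≤n , inj₁ refl)               = n , 1≤n , inj₁ (map-pow f n _)
alternatingWord-map f (n , 1≤n , inj₂ (inj₁ refl))        =
  n , 1≤n , inj₂ (inj₁ (trans (List.map-++ f (pow n _) _) (cong (_++ _) (map-pow f n _))))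
alternatingWord-map f (n , 1≤n , inj₂ (inj₂ (inj₁ refl))) = n , 1≤n , inj₂ (inj₂ (inj₁ (map-pow f n _)))
alternatingWord-map f (n , 1≤n , inj₂ (inj₂ (inj₂ refl))) =
  n , 1≤n , inj₂ (inj₂ (inj₂ (trans (List.map-++ f (pow n _) _) (cong (_++ _) (map-pow f n _)))))

-- Tokens

-- A marked word as seen from an unmarked letter a: its maximal marked runs, the unmarked occurrences
-- of a, and the other unmarked positions.  Marking a as well (markA) turns every gapA into a run that
-- merges with its neighbours.
data Token (R : Set) : Set where
  run  : R → Token R
  gapA : Token R
  gap  : Token R

mapᵗ : {R R' : Set} → (R → R') → Token R → Token R'
mapᵗ f (run b) = run (f b)
mapᵗ f gapA    = gapA
mapᵗ f gap     = gap

consRun : {R : Set} → (R → R → R) → R → List (Token R) → List (Token R)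
consRun _∙_ b (run c ∷ T) = run (b ∙ c) ∷ T
consRun _∙_ b T           = run b ∷ T

runs : {R : Set} → List (Token R) → List R
runs []          = []
runs (run b ∷ T) = b ∷ runs T
runs (_ ∷ T)     = runs T

markA : {R : Set} → (R → R → R) → R → List (Token R) → List (Token R)
markA _∙_ ε []          = []
markA _∙_ ε (run b ∷ T) = consRun _∙_ b (markA _∙_ ε T)
markA _∙_ ε (gapA ∷ T)  = consRun _∙_ ε (markA _∙_ ε T)
markA _∙_ ε (gap ∷ T)   = gap ∷ markA _∙_ ε T

tokens : (Letter → Bool) → Letter → Word → List (Token Word)
tokens mk a []      = []
tokens mk a (y ∷ w) with mk y | y ≟ a
... | true  | _     = consRun _++_ [ y ] (tokens mk a w)
... | false | yes _ = gapA ∷ tokens mk a w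
... | false | no  _ = gap ∷ tokens mk a w

-- markedAt s j w is mark (inS (take j s)) w by definition.
mark : (Letter → Bool) → Word → MarkedWord
mark mk = map (λ y → y , mk y)

splitRun : List (Token Word) → Word × List Word
splitRun (run b ∷ T) = b , runs T
splitRun T           = [] , runs T

consNE-splitRun-consRun : ∀ y T → uncurry consNE (splitRun (consRun _++_ [ y ] T)) ≡ runs (consRun _++_ [ y ] T)
consNE-splitRun-consRun y []          = refl
consNE-splitRun-consRun y (run _ ∷ T) = refl
consNE-splitRun-consRun y (gapA ∷ T)  = refl
consNE-splitRun-consRun y (gap ∷ T)   = refl

consNE-splitRun : ∀ mk a w → uncurry consNE (splitRun (tokens mk a w)) ≡ runs (tokens mk a w)
consNE-splitRun mk a []      = refl
consNE-splitRun mk a (y ∷ w) with mk y | y ≟ a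
... | true  | _     = consNE-splitRun-consRun y (tokens mk a w)
... | false | yes _ = refl
... | false | no  _ = refl

splitRun-consRun : ∀ y T → (y ∷ proj₁ (splitRun T) , proj₂ (splitRun T)) ≡ splitRun (consRun _++_ [ y ] T)
splitRun-consRun y []          = refl
splitRun-consRun y (run _ ∷ T) = refl
splitRun-consRun y (gapA ∷ T)  = refl
splitRun-consRun y (gap ∷ T)   = refl

blocksAux-mark : ∀ mk a w → blocksAux (mark mk w) ≡ splitRun (tokens mk a w)
blocksAux-mark mk a []      = refl
blocksAux-mark mk a (y ∷ w) with mk y | y ≟ a | blocksAux-mark mk a w
... | true  | _     | ih rewrite ih = splitRun-consRun y (tokens mk a w)
... | false | yes _ | ih rewrite ih = cong ([] ,_) (consNE-splitRun mk a w)
... | false | no  _ | ih rewrite ih = cong ([] ,_) (consNE-splitRun mk a w)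

blocks-mark : ∀ mk a w → blocks (mark mk w) ≡ runs (tokens mk a w)
blocks-mark mk a w rewrite blocksAux-mark mk a w = consNE-splitRun mk a w

module _ {R : Set} {_∙_ : R → R → R} (∙-assoc : ∀ b c d → (b ∙ c) ∙ d ≡ b ∙ (c ∙ d)) where

  consRun-consRun : ∀ b c T → consRun _∙_ b (consRun _∙_ c T) ≡ consRun _∙_ (b ∙ c) T
  consRun-consRun b c []          = refl
  consRun-consRun b c (run d ∷ T) = cong (λ e → run e ∷ T) (sym (∙-assoc b c d))
  consRun-consRun b c (gapA ∷ T)  = refl
  consRun-consRun b c (gap ∷ T)   = refl

  markA-consRun : ∀ ε b T → markA _∙_ ε (consRun _∙_ b T) ≡ consRun _∙_ b (markA _∙_ ε T)
  markA-consRun ε b []          = refl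
  markA-consRun ε b (run c ∷ T) = sym (consRun-consRun b c (markA _∙_ ε T))
  markA-consRun ε b (gapA ∷ T)  = refl
  markA-consRun ε b (gap ∷ T)   = refl

module _ {R R' : Set} {_∙_ : R → R → R} {_∘_ : R' → R' → R'} (f : R → R')
         (f-hom : ∀ b c → f (b ∙ c) ≡ f b ∘ f c) where

  map-consRun : ∀ b T → map (mapᵗ f) (consRun _∙_ b T) ≡ consRun _∘_ (f b) (map (mapᵗ f) T)
  map-consRun b []          = refl
  map-consRun b (run c ∷ T) = cong (λ e → run e ∷ map (mapᵗ f) T) (f-hom b c)
  map-consRun b (gapA ∷ T)  = refl
  map-consRun b (gap ∷ T)   = refl

  map-markA : ∀ {ε ε'} → f ε ≡ ε' → ∀ T → map (mapᵗ f) (markA _∙_ ε T) ≡ markA _∘_ ε' (map (mapᵗ f) T)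
  map-markA fε≡ε' []          = refl
  map-markA fε≡ε' (run b ∷ T) =
    trans (map-consRun b (markA _ _ T)) (cong (consRun _∘_ (f b)) (map-markA fε≡ε' T))
  map-markA fε≡ε' (gapA ∷ T)  =
    trans (map-consRun _ (markA _ _ T)) (cong₂ (consRun _∘_) fε≡ε' (map-markA fε≡ε' T))
  map-markA fε≡ε' (gap ∷ T)   = cong (gap ∷_) (map-markA fε≡ε' T)

runs-map : {R R' : Set} (f : R → R') (T : List (Token R)) → runs (map (mapᵗ f) T) ≡ map f (runs T)
runs-map f []          = refl
runs-map f (run b ∷ T) = cong (f b ∷_) (runs-map f T)
runs-map f (gapA ∷ T)  = runs-map f T
runs-map f (gap ∷ T)   = runs-map f T

map-mapᵗ-cong : {R R' : Set} (f g : R → R') (T : List (Token R)) →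
                map f (runs T) ≡ map g (runs T) → map (mapᵗ f) T ≡ map (mapᵗ g) T
map-mapᵗ-cong f g []          _  = refl
map-mapᵗ-cong f g (run b ∷ T) eq =
  cong₂ (λ c P → run c ∷ P) (List.∷-injectiveˡ eq) (map-mapᵗ-cong f g T (List.∷-injectiveʳ eq))
map-mapᵗ-cong f g (gapA ∷ T)  eq = cong (gapA ∷_) (map-mapᵗ-cong f g T eq)
map-mapᵗ-cong f g (gap ∷ T)   eq = cong (gap ∷_) (map-mapᵗ-cong f g T eq)

tokens-markA : ∀ mk mk' a → (∀ y → y ≢ a → mk' y ≡ mk y) → mk' a ≡ true →
               ∀ w → tokens mk' a w ≡ markA _++_ [ a ] (tokens mk a w)
tokens-markA mk mk' a mk'≗mk mk'a []      = refl
tokens-markA mk mk' a mk'≗mk mk'a (y ∷ w)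
  with ih ← tokens-markA mk mk' a mk'≗mk mk'a w | mk' y in e' | mk y in e | y ≟ a
... | true  | true  | _        =
  trans (cong (consRun _++_ [ y ]) ih) (sym (markA-consRun List.++-assoc [ a ] [ y ] (tokens mk a w)))
... | true  | false | yes refl = cong (consRun _++_ [ a ]) ih
... | false | false | no  _    = cong (gap ∷_) ih
... | true  | false | no  y≢a  = contradiction (trans (sym e') (trans (mk'≗mk y y≢a) e)) λ ()
... | false | _     | yes refl = contradiction (trans (sym e') mk'a) λ ()
... | false | true  | no  y≢a  = contradiction (trans (sym e') (trans (mk'≗mk y y≢a) e)) λ ()

profile : Letter → List (Token Word) → List (Token ℕ)
profile x = map (mapᵗ (occ x))

counts : MarkedWord → Letter → List ℕ
counts m x = map (occ x) (blocks m)

counts-mark : ∀ mk a w x → counts (mark mk w) x ≡ runs (profile x (tokens mk a w))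
counts-mark mk a w x = trans (cong (map (occ x)) (blocks-mark mk a w)) (sym (runs-map (occ x) (tokens mk a w)))

profile-consRun : ∀ x b T → profile x (consRun _++_ b T) ≡ consRun _+_ (occ x b) (profile x T)
profile-consRun x = map-consRun (occ x) (occ-++ x)

profile-markA : x ≢ a → ∀ T → profile x (markA _++_ [ a ] T) ≡ markA _+_ 0 (profile x T)
profile-markA {x} x≢a = map-markA (occ x) (occ-++ x) (occ-other x≢a)

spell : Letter → Letter → List (Token ℕ) → Word
spell x a []          = []
spell x a (run n ∷ P) = replicate n x ++ spell x a P
spell x a (gapA ∷ P)  = a ∷ spell x a P
spell x a (gap ∷ P)   = spell x a P

replicate-+-++ : ∀ n m (u : Word) → replicate (n + m) x ++ u ≡ replicate n x ++ replicate m x ++ u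
replicate-+-++ zero    m u = refl
replicate-+-++ (suc n) m u = cong (_ ∷_) (replicate-+-++ n m u)

spell-consRun : ∀ n P → spell x a (consRun _+_ n P) ≡ replicate n x ++ spell x a P
spell-consRun {x} {a} n []          = refl
spell-consRun         n (run m ∷ P) = replicate-+-++ n m _
spell-consRun         n (gapA ∷ P)  = refl
spell-consRun         n (gap ∷ P)   = refl

π-pair-∷ : ∀ x {a y} w → y ≢ a → π (x ∷ a ∷ []) (y ∷ w) ≡ replicate (occ x [ y ]) x ++ π (x ∷ a ∷ []) w
π-pair-∷ x {a} {y} w y≢a = by-cases (x ≟ y)
  where
  by-cases : Dec (x ≡ y) → π (x ∷ a ∷ []) (y ∷ w) ≡ replicate (occ x [ y ]) x ++ π (x ∷ a ∷ []) w
  by-cases (yes refl) = trans (π-∷-∈ (here refl)) (cong (λ n → replicate n x ++ π (x ∷ a ∷ []) w) (sym (occ-self x)))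
  by-cases (no  x≢y)  = trans (π-∷-∉ y∉xa) (cong (λ n → replicate n x ++ π (x ∷ a ∷ []) w) (sym (occ-other x≢y)))
    where
    y∉xa : y ∉ x ∷ a ∷ []
    y∉xa (here y≡x)          = x≢y (sym y≡x)
    y∉xa (there (here y≡a))  = y≢a y≡a
    y∉xa (there (there ()))

π-pair-spell : ∀ mk x a → mk x ≡ true → mk a ≡ false →
               ∀ w → π (x ∷ a ∷ []) w ≡ spell x a (profile x (tokens mk a w))
π-pair-spell mk x a mkx mka []      = refl
π-pair-spell mk x a mkx mka (y ∷ w) with ih ← π-pair-spell mk x a mkx mka w | mk y in mky | y ≟ a
... | true  | no y≢a = begin
  π (x ∷ a ∷ []) (y ∷ w)                                        ≡⟨ π-pair-∷ x w y≢a ⟩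
  replicate (occ x [ y ]) x ++ π (x ∷ a ∷ []) w                 ≡⟨ cong (_ ++_) ih ⟩
  replicate (occ x [ y ]) x ++ spell x a (profile x T)          ≡⟨ spell-consRun (occ x [ y ]) (profile x T) ⟨
  spell x a (consRun _+_ (occ x [ y ]) (profile x T))           ≡⟨ cong (spell x a) (profile-consRun x [ y ] T) ⟨
  spell x a (profile x (consRun _++_ [ y ] T))                  ∎
  where
  open ≡-Reasoning
  T : List (Token Word)
  T = tokens mk a w
... | true  | yes refl = contradiction (trans (sym mky) mka) λ ()
... | false | yes refl = trans (π-∷-∈ (there (here refl))) (cong (a ∷_) ih)
... | false | no y≢a  = trans (π-∷-∉ y∉xa) ih
  where
  y∉xa : y ∉ x ∷ a ∷ []
  y∉xa (here refl)          = contradiction (trans (sym mky) mkx) λ ()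
  y∉xa (there (here y≡a))   = y≢a y≡a
  y∉xa (there (there ()))

module _ {c : ℕ} where

  Any≥-consRun-head : ∀ {n} P → c ≤ n → Any (c ≤_) (runs (consRun _+_ n P))
  Any≥-consRun-head []          c≤n = here c≤n
  Any≥-consRun-head (run m ∷ P) c≤n = here (≤-trans c≤n (m≤m+n _ m))
  Any≥-consRun-head (gapA ∷ P)  c≤n = here c≤n
  Any≥-consRun-head (gap ∷ P)   c≤n = here c≤n

  Any≥-consRun : ∀ n P → Any (c ≤_) (runs P) → Any (c ≤_) (runs (consRun _+_ n P))
  Any≥-consRun n (run m ∷ P) (here c≤m) = here (≤-trans c≤m (m≤n+m m n))
  Any≥-consRun n (run m ∷ P) (there p)  = there p
  Any≥-consRun n (gapA ∷ P)  p          = there p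
  Any≥-consRun n (gap ∷ P)   p          = there p

  Any≥-markA : ∀ P → Any (c ≤_) (runs P) → Any (c ≤_) (runs (markA _+_ 0 P))
  Any≥-markA (run n ∷ P) (here c≤n) = Any≥-consRun-head (markA _+_ 0 P) c≤n
  Any≥-markA (run n ∷ P) (there p)  = Any≥-consRun n (markA _+_ 0 P) (Any≥-markA P p)
  Any≥-markA (gapA ∷ P)  p          = Any≥-consRun 0 (markA _+_ 0 P) (Any≥-markA P p)
  Any≥-markA (gap ∷ P)   p          = Any≥-markA P p

profile-nonempty : ∀ mk a → mk x ≡ true → ∀ {w} → x ∈ w → Any (1 ≤_) (runs (profile x (tokens mk a w)))
profile-nonempty {x} mk a mkx {x ∷ w} (here refl) with mk x | x ≟ a
... | true  | _ rewrite profile-consRun x [ x ] (tokens mk a w) | occ-self x =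
  Any≥-consRun-head (profile x (tokens mk a w)) (s≤s z≤n)
... | false | _ = contradiction mkx λ ()
profile-nonempty {x} mk a mkx {y ∷ w} (there x∈w) with mk y | y ≟ a | profile-nonempty mk a mkx x∈w
... | true  | _     | p rewrite profile-consRun x [ y ] (tokens mk a w) =
  Any≥-consRun (occ x [ y ]) (profile x (tokens mk a w)) p
... | false | yes _ | p = p
... | false | no  _ | p = p

spell-square : ∀ P → Any (2 ≤_) (runs P) → ∃ λ p → ∃ λ q → spell x a P ≡ p ++ x ∷ x ∷ q
spell-square {x} {a} (run (suc (suc n)) ∷ P) (here (s≤s (s≤s _))) = [] , replicate n x ++ spell x a P , refl
spell-square         (run (suc zero) ∷ P) (here (s≤s ()))
spell-square {x} {a} (run n ∷ P) (there sq) with p , q , eq ← spell-square P sq =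
  replicate n x ++ p , q , trans (cong (replicate n x ++_) eq) (sym (List.++-assoc (replicate n x) p (x ∷ x ∷ q)))
spell-square {x} {a} (gapA ∷ P) sq with p , q , eq ← spell-square P sq = a ∷ p , q , cong (a ∷_) eq
spell-square         (gap ∷ P)  sq = spell-square P sq

spell-square⇒¬alternating : x ≢ a → ∀ P → Any (2 ≤_) (runs P) → ¬ AlternatingWord x a (spell x a P)
spell-square⇒¬alternating x≢a P sq alt with p , q , eq ← spell-square P sq =
  ¬Linked≢-square p q (subst (Linked _≢_) eq (alternatingWord⇒Linked≢ x≢a alt))

replace : Letter → Letter → Letter → Letter
replace x y z with z ≟ x
... | yes _ = y
... | no  _ = z

replace-≡ : ∀ x y → replace x y x ≡ y
replace-≡ x y with x ≟ x
... | yes _   = refl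
... | no  x≢x = contradiction refl x≢x

replace-≢ : ∀ x y {z} → z ≢ x → replace x y z ≡ z
replace-≢ x y {z} z≢x with z ≟ x
... | yes z≡x = contradiction z≡x z≢x
... | no  _   = refl

map-replace-spell : a ≢ x → ∀ y P → map (replace x y) (spell x a P) ≡ spell y a P
map-replace-spell         a≢x y []          = refl
map-replace-spell {a} {x} a≢x y (run n ∷ P) = begin
  map (replace x y) (replicate n x ++ spell x a P)                         ≡⟨ List.map-++ (replace x y) (replicate n x) _ ⟩
  map (replace x y) (replicate n x) ++ map (replace x y) (spell x a P)     ≡⟨ cong₂ _++_ eq₁ (map-replace-spell a≢x y P) ⟩
  replicate n y ++ spell y a P                                             ∎
  where
  open ≡-Reasoning
  eq₁ : map (replace x y) (replicate n x) ≡ replicate n y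
  eq₁ = trans (List.map-replicate (replace x y) n x) (cong (λ z → replicate n z) (replace-≡ x y))
map-replace-spell {a} {x} a≢x y (gapA ∷ P)  = cong₂ _∷_ (replace-≢ x y a≢x) (map-replace-spell a≢x y P)
map-replace-spell         a≢x y (gap ∷ P)   = map-replace-spell a≢x y P

alternating-spell-replace : a ≢ x → ∀ y P → AlternatingWord x a (spell x a P) → AlternatingWord y a (spell y a P)
alternating-spell-replace {a} {x} a≢x y P alt =
  subst₂ (λ b v → AlternatingWord b a v) (replace-≡ x y) (map-replace-spell a≢x y P)
    (subst (λ b → AlternatingWord (replace x y x) b (map (replace x y) (spell x a P))) (replace-≢ x y a≢x)
      (alternatingWord-map (replace x y) alt))

-- Labels

tupleOfCounts : (k : ℕ) → List ℕ → Vec Bool k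
tupleOfCounts zero    _        = []
tupleOfCounts (suc k) []       = false ∷ tupleOfCounts k []
tupleOfCounts (suc k) (c ∷ cs) = isOne c ∷ tupleOfCounts k cs

labelOf : (k : ℕ) → List ℕ → Lab k
labelOf k cs with any? (2 ≤?_) cs
... | yes _ = two
... | no  _ = tup (tupleOfCounts k cs)

tup-injective : ∀ {k} {u v : Vec Bool k} → tup u ≡ tup v → u ≡ v
tup-injective refl = refl

labelOf-two : ∀ k {cs} → Any (2 ≤_) cs → labelOf k cs ≡ two
labelOf-two k {cs} sq with any? (2 ≤?_) cs
... | yes _   = refl
... | no  ¬sq = contradiction sq ¬sq

labelOf-tup : ∀ k {cs} → ¬ Any (2 ≤_) cs → labelOf k cs ≡ tup (tupleOfCounts k cs)
labelOf-tup k {cs} ¬sq with any? (2 ≤?_) cs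
... | yes sq = contradiction sq ¬sq
... | no  _  = refl

tupleOf≡tupleOfCounts : ∀ k x bs → tupleOf k x bs ≡ tupleOfCounts k (map (occ x) bs)
tupleOf≡tupleOfCounts zero    x bs       = refl
tupleOf≡tupleOfCounts (suc k) x []       = cong (false ∷_) (tupleOf≡tupleOfCounts k x [])
tupleOf≡tupleOfCounts (suc k) x (b ∷ bs) = cong (_ ∷_) (tupleOf≡tupleOfCounts k x bs)

SomeBlockTwice⇔Any : ∀ x bs → SomeBlockTwice x bs ⇔ Any (2 ≤_) (map (occ x) bs)
SomeBlockTwice⇔Any x bs = mk⇔ (λ (b , b∈bs , 2≤) → Any.map⁺ (lose b∈bs 2≤)) (find ∘ Any.map⁻)

HasLab-labelOf : ∀ k m x → HasLab k m x (labelOf k (counts m x))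
HasLab-labelOf k m x with any? (2 ≤?_) (counts m x)
... | yes sq  = isTwo (Equivalence.from (SomeBlockTwice⇔Any x (blocks m)) sq)
... | no  ¬sq = subst (HasLab k m x ∘ tup) (tupleOf≡tupleOfCounts k x (blocks m))
                  (isTup (¬sq ∘ Equivalence.to (SomeBlockTwice⇔Any x (blocks m))))

HasLab⇒≡labelOf : ∀ {k m x ℓ} → HasLab k m x ℓ → ℓ ≡ labelOf k (counts m x)
HasLab⇒≡labelOf {k} {m} {x} (isTwo sq) =
  sym (labelOf-two k (Equivalence.to (SomeBlockTwice⇔Any x (blocks m)) sq))
HasLab⇒≡labelOf {k} {m} {x} (isTup ¬sq) = begin
  tup (tupleOf k x (blocks m))           ≡⟨ cong tup (tupleOf≡tupleOfCounts k x (blocks m)) ⟩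
  tup (tupleOfCounts k (counts m x))     ≡⟨ labelOf-tup k (¬sq ∘ Equivalence.from (SomeBlockTwice⇔Any x (blocks m))) ⟨
  labelOf k (counts m x)                 ∎
  where open ≡-Reasoning

isOne-injective : ∀ {c d} → c < 2 → d < 2 → isOne c ≡ isOne d → c ≡ d
isOne-injective {zero}     {zero}     _ _ _  = refl
isOne-injective {suc zero} {suc zero} _ _ _  = refl
isOne-injective {zero}     {suc zero} _ _ ()
isOne-injective {suc zero} {zero}     _ _ ()
isOne-injective {suc (suc _)} (s≤s (s≤s ())) _
isOne-injective {_} {suc (suc _)} _ (s≤s (s≤s ()))

tupleOfCounts-injective : ∀ k {cs ds} → ¬ Any (2 ≤_) cs → ¬ Any (2 ≤_) ds → length cs ≡ length ds → length cs ≤ k →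
                          tupleOfCounts k cs ≡ tupleOfCounts k ds → cs ≡ ds
tupleOfCounts-injective k {[]}     {[]}     _ _ _ _ _ = refl
tupleOfCounts-injective (suc k) {c ∷ cs} {d ∷ ds} ¬sqc ¬sqd len (s≤s len≤k) eq = cong₂ _∷_
  (isOne-injective (≰⇒> (¬sqc ∘ here)) (≰⇒> (¬sqd ∘ here)) (Vec.∷-injectiveˡ eq))
  (tupleOfCounts-injective k (¬sqc ∘ there) (¬sqd ∘ there) (suc-injective len) len≤k (Vec.∷-injectiveʳ eq))

labelOf-injective : ∀ k {cs ds} → ¬ Any (2 ≤_) cs → length cs ≡ length ds → length cs ≤ k →
                    labelOf k cs ≡ labelOf k ds → cs ≡ ds
labelOf-injective k {cs} {ds} ¬sqc len len≤k eq = by-cases (any? (2 ≤?_) ds)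
  where
  by-cases : Dec (Any (2 ≤_) ds) → cs ≡ ds
  by-cases (yes sqd) = contradiction (trans (sym (labelOf-tup k ¬sqc)) (trans eq (labelOf-two k sqd))) λ ()
  by-cases (no ¬sqd) = tupleOfCounts-injective k ¬sqc ¬sqd len len≤k
                         (tup-injective (trans (sym (labelOf-tup k ¬sqc)) (trans eq (labelOf-tup k ¬sqd))))

labelOf≡two⇒Any : ∀ k {cs} → labelOf k cs ≡ two → Any (2 ≤_) cs
labelOf≡two⇒Any k {cs} eq with any? (2 ≤?_) cs
... | yes sq = sq
... | no  _  = contradiction eq λ ()

zeros : ∀ {k} → Lab k
zeros {k} = tup (Vec.replicate k false)

tupleOfCounts-≢-replicate : ∀ k {cs} → Any (1 ≤_) cs → ¬ Any (2 ≤_) cs → length cs ≤ k →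
                            tupleOfCounts k cs ≢ Vec.replicate k false
tupleOfCounts-≢-replicate (suc k) (here (s≤s {n = zero} _)) _ _ ()
tupleOfCounts-≢-replicate (suc k) (here (s≤s {n = suc _} _)) ¬sq _ _ = ¬sq (here (s≤s (s≤s z≤n)))
tupleOfCounts-≢-replicate (suc k) (there pos) ¬sq (s≤s len≤k) eq =
  tupleOfCounts-≢-replicate k pos (¬sq ∘ there) len≤k (Vec.∷-injectiveʳ eq)

labelOf-≢-zeros : ∀ k {cs} → Any (1 ≤_) cs → length cs ≤ k → labelOf k cs ≢ zeros
labelOf-≢-zeros k {cs} pos len≤k with any? (2 ≤?_) cs
... | yes _   = λ ()
... | no  ¬sq = tupleOfCounts-≢-replicate k pos ¬sq len≤k ∘ tup-injective

length-runs-profile : ∀ x T → length (runs (profile x T)) ≡ length (runs T)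
length-runs-profile x T = trans (cong length (runs-map (occ x) T)) (List.length-map (occ x) (runs T))

module _ (k : ℕ) (T : List (Token Word)) (T≤k : length (runs T) ≤ k) {x y : Letter}
         (same : labelOf k (runs (profile x T)) ≡ labelOf k (runs (profile y T))) where

  -- A label without a 2 records every per-block count exactly, because there are at most k blocks.
  squares-or-equal-profiles : (Any (2 ≤_) (runs (profile x T)) × Any (2 ≤_) (runs (profile y T)))
                              ⊎ profile x T ≡ profile y T
  squares-or-equal-profiles = by-cases (any? (2 ≤?_) (runs (profile x T)))
    where
    open ≡-Reasoning
    by-cases : Dec (Any (2 ≤_) (runs (profile x T))) →
               (Any (2 ≤_) (runs (profile x T)) × Any (2 ≤_) (runs (profile y T))) ⊎ profile x T ≡ profile y T
    by-cases (yes sqx) = inj₁ (sqx , labelOf≡two⇒Any k (trans (sym same) (labelOf-two k sqx)))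
    by-cases (no ¬sqx) = inj₂ (map-mapᵗ-cong (occ x) (occ y) T (begin
      map (occ x) (runs T)     ≡⟨ runs-map (occ x) T ⟨
      runs (profile x T)       ≡⟨ labelOf-injective k ¬sqx len (subst (_≤ k) (sym (length-runs-profile x T)) T≤k) same ⟩
      runs (profile y T)       ≡⟨ runs-map (occ y) T ⟩
      map (occ y) (runs T)     ∎))
      where
      len : length (runs (profile x T)) ≡ length (runs (profile y T))
      len = trans (length-runs-profile x T) (sym (length-runs-profile y T))

  same-label-after-markA : labelOf k (runs (markA _+_ 0 (profile x T))) ≡ labelOf k (runs (markA _+_ 0 (profile y T)))
  same-label-after-markA with squares-or-equal-profiles
  ... | inj₁ (sqx , sqy) =
    trans (labelOf-two k (Any≥-markA (profile x T) sqx)) (sym (labelOf-two k (Any≥-markA (profile y T) sqy)))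
  ... | inj₂ eq          = cong (λ P → labelOf k (runs (markA _+_ 0 P))) eq

  same-alternation : a ≢ x →
                     AlternatingWord x a (spell x a (profile x T)) → AlternatingWord y a (spell y a (profile y T))
  same-alternation {a} a≢x alt with squares-or-equal-profiles
  ... | inj₁ (sqx , _) = contradiction alt (spell-square⇒¬alternating (a≢x ∘ sym) (profile x T) sqx)
  ... | inj₂ eq        =
    subst (λ P → AlternatingWord y a (spell y a P)) eq (alternating-spell-replace a≢x y (profile x T) alt)

-- Relabelling expressions

module Transposition {A : Set} (_≟ᴬ_ : DecidableEquality A) where

  swap : A → A → A → A
  swap p q x with x ≟ᴬ p
  ... | yes _ = q
  ... | no  _ with x ≟ᴬ q
  ...   | yes _ = p
  ...   | no  _ = x

  swap-p : ∀ p q → swap p q p ≡ q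
  swap-p p q with p ≟ᴬ p
  ... | yes _   = refl
  ... | no  p≢p = contradiction refl p≢p

  swap-q : ∀ p q → swap p q q ≡ p
  swap-q p q with q ≟ᴬ p
  ... | yes refl = refl
  ... | no  _ with q ≟ᴬ q
  ...   | yes _   = refl
  ...   | no  q≢q = contradiction refl q≢q

  swap-other : ∀ p q {x} → x ≢ p → x ≢ q → swap p q x ≡ x
  swap-other p q {x} x≢p x≢q with x ≟ᴬ p
  ... | yes x≡p = contradiction x≡p x≢p
  ... | no  _ with x ≟ᴬ q
  ...   | yes x≡q = contradiction x≡q x≢q
  ...   | no  _   = refl

  swap-involutive : ∀ p q x → swap p q (swap p q x) ≡ x
  swap-involutive p q x with x ≟ᴬ p
  ... | yes refl = swap-q x q
  ... | no  x≢p with x ≟ᴬ q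
  ...   | yes refl = swap-p p x
  ...   | no  x≢q  = swap-other p q x≢p x≢q

  swap-injective : ∀ p q → Injective _≡_ _≡_ (swap p q)
  swap-injective p q {x} {y} eq =
    trans (sym (swap-involutive p q x)) (trans (cong (swap p q) eq) (swap-involutive p q y))

  -- Post-composing with a transposition fixes one more point at a time.
  extend-injective : (g : A → A) {P : A → Set} → Decidable P → (∀ {x y} → P x → P y → g x ≡ g y → x ≡ y) →
                     ∀ xs → ∃ λ h → Injective _≡_ _≡_ h × (∀ {x} → x ∈ xs → P x → h x ≡ g x)
  extend-injective g P? g-inj [] = (λ x → x) , (λ eq → eq) , λ ()
  extend-injective g {P} P? g-inj (z ∷ xs) with extend-injective g P? g-inj xs | P? z
  ... | h , h-inj , h≗g | no ¬Pz = h , h-inj , agree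
    where
    agree : ∀ {x} → x ∈ z ∷ xs → P x → h x ≡ g x
    agree (here refl) Px = contradiction Px ¬Pz
    agree (there x∈)  Px = h≗g x∈ Px
  ... | h , h-inj , h≗g | yes Pz = swap (h z) (g z) ∘ h , h-inj ∘ swap-injective (h z) (g z) , agree
    where
    agree : ∀ {x} → x ∈ z ∷ xs → P x → swap (h z) (g z) (h x) ≡ g x
    agree (here refl) Px = swap-p (h z) (g z)
    agree {x} (there x∈) Px with x ≟ᴬ z
    ... | yes refl = swap-p (h x) (g x)
    ... | no  x≢z  rewrite h≗g x∈ Px =
      swap-other (h z) (g z) (λ gx≡hz → x≢z (h-inj (trans (h≗g x∈ Px) gx≡hz))) (x≢z ∘ g-inj Px Pz)

module Canonical {A : Set} (_≟ᴬ_ : DecidableEquality A) (elems : List A) (∈-elems : ∀ x → x ∈ elems) (g : A → A) where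

  search : A → A → List A → A
  search v d []       = d
  search v d (x ∷ xs) with g x ≟ᴬ v
  ... | yes _ = x
  ... | no  _ = search v d xs

  search-sound : ∀ v d xs → g d ≡ v → g (search v d xs) ≡ v
  search-sound v d []       gd≡v = gd≡v
  search-sound v d (x ∷ xs) gd≡v with g x ≟ᴬ v
  ... | yes gx≡v = gx≡v
  ... | no  _    = search-sound v d xs gd≡v

  search-default-irrelevant : ∀ v d d' {x} xs → x ∈ xs → g x ≡ v → search v d xs ≡ search v d' xs
  search-default-irrelevant v d d' (y ∷ xs) x∈ gx≡v with g y ≟ᴬ v
  ... | yes _ = refl
  search-default-irrelevant v d d' (y ∷ xs) (here refl) gx≡v | no gy≢v = contradiction gx≡v gy≢v
  search-default-irrelevant v d d' (y ∷ xs) (there x∈) gx≡v  | no _    = search-default-irrelevant v d d' xs x∈ gx≡v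

  canon : A → A
  canon x = search (g x) x elems

  g-canon : ∀ x → g (canon x) ≡ g x
  g-canon x = search-sound (g x) x elems refl

  canon-cong : ∀ {x y} → g x ≡ g y → canon x ≡ canon y
  canon-cong {x} {y} gx≡gy rewrite gx≡gy = search-default-irrelevant (g y) x y elems (∈-elems y) refl

  canon-idem : ∀ x → canon (canon x) ≡ canon x
  canon-idem x = canon-cong (g-canon x)

  IsCanon : A → Set
  IsCanon x = canon x ≡ x

  IsCanon-injective : ∀ {x y} → IsCanon x → IsCanon y → g x ≡ g y → x ≡ y
  IsCanon-injective cx cy gx≡gy = trans (sym cx) (trans (canon-cong gx≡gy) cy)

  open Transposition _≟ᴬ_

  canon-factorisation : ∃ λ h → Injective _≡_ _≡_ h × (∀ x → h (canon x) ≡ g x)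
  canon-factorisation with h , h-inj , h≗g ← extend-injective g (λ x → canon x ≟ᴬ x) IsCanon-injective elems =
    h , h-inj , λ x → trans (h≗g (∈-elems (canon x)) (canon-idem x)) (g-canon x)

module _ {k : ℕ} where

  _≟ˡ_ : DecidableEquality (Lab k)
  tup u ≟ˡ tup v = map′ (cong tup) tup-injective (Vec.≡-dec Bool._≟_ u v)
  tup _ ≟ˡ two   = no λ ()
  two   ≟ˡ tup _ = no λ ()
  two   ≟ˡ two   = yes refl

allVecs : (n : ℕ) → List (Vec Bool n)
allVecs zero    = [ [] ]
allVecs (suc n) = map (true ∷_) (allVecs n) ++ map (false ∷_) (allVecs n)

∈-allVecs : ∀ {n} (v : Vec Bool n) → v ∈ allVecs n
∈-allVecs []          = here refl
∈-allVecs (true ∷ v)  = ∈-++⁺ˡ (∈-map⁺ (true ∷_) (∈-allVecs v))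
∈-allVecs (false ∷ v) = ∈-++⁺ʳ (map (true ∷_) (allVecs _)) (∈-map⁺ (false ∷_) (∈-allVecs v))

allLabs : (k : ℕ) → List (Lab k)
allLabs k = two ∷ map tup (allVecs k)

∈-allLabs : ∀ {k} (ℓ : Lab k) → ℓ ∈ allLabs k
∈-allLabs two     = here refl
∈-allLabs (tup v) = there (∈-map⁺ tup (∈-allVecs v))

record Relabelling {k : ℕ} (E E' : Expr k) (R : Lab k → Lab k → Set) : Set where
  field
    wf    : WF E'
    node⇒ : ∀ {v} → HasNode E' v → HasNode E v
    node⇐ : ∀ {v} → HasNode E v → HasNode E' v
    edge⇒ : ∀ {x y} → Edge E' x y → Edge E x y
    edge⇐ : ∀ {x y} → Edge E x y → Edge E' x y
    label : ∀ {v ℓ'} → E' ∋ v ∶ ℓ' → ∃ λ ℓ → E ∋ v ∶ ℓ × R ℓ ℓ'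

module _ {k : ℕ} where

  Relabelling-refl : ∀ {E : Expr k} → WF E → Relabelling E E _≡_
  Relabelling-refl wfE = record
    { wf = wfE ; node⇒ = λ p → p ; node⇐ = λ p → p ; edge⇒ = λ e → e ; edge⇐ = λ e → e
    ; label = λ p → _ , p , refl }

  Relabelling-trans : ∀ {E₁ E₂ E₃ : Expr k} {R R'} → Relabelling E₁ E₂ R → Relabelling E₂ E₃ R' →
                      Relabelling E₁ E₃ (λ ℓ ℓ'' → ∃ λ ℓ' → R ℓ ℓ' × R' ℓ' ℓ'')
  Relabelling-trans r r' = record
    { wf = R₂.wf
    ; node⇒ = R₁.node⇒ ∘ R₂.node⇒ ; node⇐ = R₂.node⇐ ∘ R₁.node⇐
    ; edge⇒ = R₁.edge⇒ ∘ R₂.edge⇒ ; edge⇐ = R₂.edge⇐ ∘ R₁.edge⇐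
    ; label = λ p → let ℓ' , p' , R'ℓ'ℓ'' = R₂.label p ; ℓ , p'' , Rℓℓ' = R₁.label p' in ℓ , p'' , ℓ' , Rℓℓ' , R'ℓ'ℓ'' }
    where
    module R₁ = Relabelling r
    module R₂ = Relabelling r'

  Relabelling-weaken : ∀ {E E' : Expr k} {R R' : Lab k → Lab k → Set} → (∀ {ℓ ℓ'} → R ℓ ℓ' → R' ℓ ℓ') →
                       Relabelling E E' R → Relabelling E E' R'
  Relabelling-weaken R⇒R' r = record
    { Relabelling r ; label = λ p → let ℓ , p' , Rℓℓ' = Relabelling.label r p in ℓ , p' , R⇒R' Rℓℓ' }

  RenameStep : Lab k → Lab k → Lab k → Lab k → Set
  RenameStep a b ℓ ℓ' = (ℓ ≡ a × ℓ' ≡ b) ⊎ (ℓ ≢ a × ℓ' ≡ ℓ)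

  ρ-relabelling : ∀ a b {E : Expr k} → WF E → Relabelling E (ρ a b E) (RenameStep a b)
  ρ-relabelling a b {E} wfE = record
    { wf = wf-ρ wfE
    ; node⇒ = λ { (_ , n-ρ≡ p) → _ , p ; (_ , n-ρ≢ p _) → _ , p }
    ; node⇐ = λ (ℓ , p) → node⇐ ℓ p
    ; edge⇒ = λ { (e-ρ e) → e }
    ; edge⇐ = e-ρ
    ; label = λ { (n-ρ≡ p) → a , p , inj₁ (refl , refl) ; (n-ρ≢ p ℓ≢a) → _ , p , inj₂ (ℓ≢a , refl) } }
    where
    node⇐ : ∀ {v} ℓ → E ∋ v ∶ ℓ → HasNode (ρ a b E) v
    node⇐ ℓ p with ℓ ≟ˡ a
    ... | yes refl = b , n-ρ≡ p
    ... | no  ℓ≢a  = ℓ , n-ρ≢ p ℓ≢a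

  module _ (h : Lab k → Lab k) (h-inj : Injective _≡_ _≡_ h) where

    mapLabels : Expr k → Expr k
    mapLabels (node ℓ v)      = node (h ℓ) v
    mapLabels (E ⊕ F)         = mapLabels E ⊕ mapLabels F
    mapLabels (η ℓ₁ ℓ₂ ℓ₁≢ℓ₂ E) = η (h ℓ₁) (h ℓ₂) (ℓ₁≢ℓ₂ ∘ h-inj) (mapLabels E)
    mapLabels (ρ ℓ₁ ℓ₂ E)     = ρ (h ℓ₁) (h ℓ₂) (mapLabels E)

    mapLabels-∋⁺ : ∀ {E v ℓ} → E ∋ v ∶ ℓ → mapLabels E ∋ v ∶ h ℓ
    mapLabels-∋⁺ n-node         = n-node
    mapLabels-∋⁺ (n-⊕ˡ p)       = n-⊕ˡ (mapLabels-∋⁺ p)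
    mapLabels-∋⁺ (n-⊕ʳ p)       = n-⊕ʳ (mapLabels-∋⁺ p)
    mapLabels-∋⁺ (n-η p)        = n-η (mapLabels-∋⁺ p)
    mapLabels-∋⁺ (n-ρ≡ p)       = n-ρ≡ (mapLabels-∋⁺ p)
    mapLabels-∋⁺ (n-ρ≢ p ℓ≢ℓ₁)  = n-ρ≢ (mapLabels-∋⁺ p) (ℓ≢ℓ₁ ∘ h-inj)

    mapLabels-∋⁻ : ∀ E {v ℓ'} → mapLabels E ∋ v ∶ ℓ' → ∃ λ ℓ → E ∋ v ∶ ℓ × ℓ' ≡ h ℓ
    mapLabels-∋⁻ (node ℓ v) n-node = ℓ , n-node , refl
    mapLabels-∋⁻ (E ⊕ F) (n-⊕ˡ p) with ℓ , q , eq ← mapLabels-∋⁻ E p = ℓ , n-⊕ˡ q , eq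
    mapLabels-∋⁻ (E ⊕ F) (n-⊕ʳ p) with ℓ , q , eq ← mapLabels-∋⁻ F p = ℓ , n-⊕ʳ q , eq
    mapLabels-∋⁻ (η _ _ _ E) (n-η p) with ℓ , q , eq ← mapLabels-∋⁻ E p = ℓ , n-η q , eq
    mapLabels-∋⁻ (ρ ℓ₁ ℓ₂ E) (n-ρ≡ p) with ℓ , q , eq ← mapLabels-∋⁻ E p with refl ← h-inj eq = ℓ₂ , n-ρ≡ q , refl
    mapLabels-∋⁻ (ρ ℓ₁ ℓ₂ E) (n-ρ≢ p hℓ≢hℓ₁) with ℓ , q , refl ← mapLabels-∋⁻ E p =
      ℓ , n-ρ≢ q (hℓ≢hℓ₁ ∘ cong h) , refl

    mapLabels-∋⁻-exact : ∀ E {v ℓ} → mapLabels E ∋ v ∶ h ℓ → E ∋ v ∶ ℓ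
    mapLabels-∋⁻-exact E p with ℓ , q , eq ← mapLabels-∋⁻ E p with refl ← h-inj eq = q

    mapLabels-edge⁺ : ∀ {E x y} → Edge E x y → Edge (mapLabels E) x y
    mapLabels-edge⁺ (e-⊕ˡ e)     = e-⊕ˡ (mapLabels-edge⁺ e)
    mapLabels-edge⁺ (e-⊕ʳ e)     = e-⊕ʳ (mapLabels-edge⁺ e)
    mapLabels-edge⁺ (e-η e)      = e-η (mapLabels-edge⁺ e)
    mapLabels-edge⁺ (e-new₁ p q) = e-new₁ (mapLabels-∋⁺ p) (mapLabels-∋⁺ q)
    mapLabels-edge⁺ (e-new₂ p q) = e-new₂ (mapLabels-∋⁺ p) (mapLabels-∋⁺ q)
    mapLabels-edge⁺ (e-ρ e)      = e-ρ (mapLabels-edge⁺ e)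

    mapLabels-edge⁻ : ∀ E {x y} → Edge (mapLabels E) x y → Edge E x y
    mapLabels-edge⁻ (E ⊕ F)     (e-⊕ˡ e)     = e-⊕ˡ (mapLabels-edge⁻ E e)
    mapLabels-edge⁻ (E ⊕ F)     (e-⊕ʳ e)     = e-⊕ʳ (mapLabels-edge⁻ F e)
    mapLabels-edge⁻ (η _ _ _ E) (e-η e)      = e-η (mapLabels-edge⁻ E e)
    mapLabels-edge⁻ (η _ _ _ E) (e-new₁ p q) = e-new₁ (mapLabels-∋⁻-exact E p) (mapLabels-∋⁻-exact E q)
    mapLabels-edge⁻ (η _ _ _ E) (e-new₂ p q) = e-new₂ (mapLabels-∋⁻-exact E p) (mapLabels-∋⁻-exact E q)
    mapLabels-edge⁻ (ρ _ _ E)   (e-ρ e)      = e-ρ (mapLabels-edge⁻ E e)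

    mapLabels-node⁻ : ∀ E {v} → HasNode (mapLabels E) v → HasNode E v
    mapLabels-node⁻ E (_ , p) with ℓ , q , _ ← mapLabels-∋⁻ E p = ℓ , q

    mapLabels-wf : ∀ {E} → WF E → WF (mapLabels E)
    mapLabels-wf wf-node          = wf-node
    mapLabels-wf {E ⊕ F} (wf-⊕ wfE wfF disj) =
      wf-⊕ (mapLabels-wf wfE) (mapLabels-wf wfF) (λ v p q → disj v (mapLabels-node⁻ E p) (mapLabels-node⁻ F q))
    mapLabels-wf (wf-η wfE)       = wf-η (mapLabels-wf wfE)
    mapLabels-wf (wf-ρ wfE)       = wf-ρ (mapLabels-wf wfE)

    mapLabels-relabelling : ∀ {E} → WF E → Relabelling E (mapLabels E) (λ ℓ ℓ' → ℓ' ≡ h ℓ)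
    mapLabels-relabelling {E} wfE = record
      { wf = mapLabels-wf wfE
      ; node⇒ = mapLabels-node⁻ E ; node⇐ = λ (ℓ , p) → h ℓ , mapLabels-∋⁺ p
      ; edge⇒ = mapLabels-edge⁻ E ; edge⇐ = mapLabels-edge⁺
      ; label = mapLabels-∋⁻ E }

  module _ (r : Lab k → Lab k) (r-idem : ∀ ℓ → r (r ℓ) ≡ r ℓ) where

    collapse : List (Lab k) → Expr k → Expr k
    collapse Ls E = foldr (λ ℓ → ρ ℓ (r ℓ)) E Ls

    Collapsed : List (Lab k) → Lab k → Lab k → Set
    Collapsed Ls ℓ ℓ' = (ℓ' ≡ ℓ ⊎ ℓ' ≡ r ℓ) × (ℓ ∈ Ls → ℓ' ≡ r ℓ)

    collapse-relabelling : ∀ Ls {E} → WF E → Relabelling E (collapse Ls E) (Collapsed Ls)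
    collapse-relabelling []       wfE = Relabelling-weaken (λ { refl → inj₁ refl , λ () }) (Relabelling-refl wfE)
    collapse-relabelling (ℓ ∷ Ls) {E} wfE =
      Relabelling-weaken step (Relabelling-trans IH (ρ-relabelling ℓ (r ℓ) (Relabelling.wf IH)))
      where
      IH : Relabelling E (collapse Ls E) (Collapsed Ls)
      IH = collapse-relabelling Ls wfE
      r-stable : ∀ {o c} → c ≡ o ⊎ c ≡ r o → r c ≡ r o
      r-stable (inj₁ refl) = refl
      r-stable (inj₂ refl) = r-idem _
      step : ∀ {o c'} → (∃ λ c → Collapsed Ls o c × RenameStep ℓ (r ℓ) c c') → Collapsed (ℓ ∷ Ls) o c'
      step (c , (c≡o∨ro , _) , inj₁ (refl , refl)) = inj₂ (r-stable c≡o∨ro) , λ _ → r-stable c≡o∨ro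
      step (c , (c≡o∨ro , o∈Ls⇒) , inj₂ (c≢ℓ , refl)) = c≡o∨ro , λ where
        (here refl) → fromInj₂ (λ c≡o → contradiction c≡o c≢ℓ) c≡o∨ro
        (there o∈Ls) → o∈Ls⇒ o∈Ls

  open Canonical (_≟ˡ_ {k}) (allLabs k) ∈-allLabs using (canon; canon-idem; canon-factorisation)

  -- A non-injective g cannot be pushed through η, so each g-class is first collapsed to a canonical
  -- member with ρ, and the canonical members are then renamed injectively.
  relabel : (g : Lab k → Lab k) (E : Expr k) → WF E → ∃ λ E' → Relabelling E E' (λ ℓ ℓ' → ℓ' ≡ g ℓ)
  relabel g E wfE with h , h-inj , h∘canon≗g ← canon-factorisation g =
    mapLabels h h-inj E₁ ,
    Relabelling-weaken agree (Relabelling-trans collapsed (mapLabels-relabelling h h-inj (Relabelling.wf collapsed)))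
    where
    E₁ : Expr k
    E₁ = collapse (canon g) (canon-idem g) (allLabs k) E
    collapsed : Relabelling E E₁ (Collapsed (canon g) (canon-idem g) (allLabs k))
    collapsed = collapse-relabelling (canon g) (canon-idem g) (allLabs k) wfE
    agree : ∀ {o ℓ'} → (∃ λ c → Collapsed (canon g) (canon-idem g) (allLabs k) o c × ℓ' ≡ h c) → ℓ' ≡ g o
    agree {o} (c , (_ , all) , refl) rewrite all (∈-allLabs o) = h∘canon≗g o

-- Joining a label to a list of labels

module _ {k : ℕ} (z : Lab k) where

  join : List (Lab k) → Expr k → Expr k
  join []       F = F
  join (ℓ ∷ Ls) F with z ≟ˡ ℓ
  ... | yes _   = join Ls F
  ... | no  z≢ℓ = η z ℓ z≢ℓ (join Ls F)

  JoinEdge : List (Lab k) → Expr k → Letter → Letter → Set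
  JoinEdge Ls F x y = ∃ λ ℓ → ℓ ∈ Ls × z ≢ ℓ × ((F ∋ x ∶ z × F ∋ y ∶ ℓ) ⊎ (F ∋ x ∶ ℓ × F ∋ y ∶ z))

  JoinEdge-there : ∀ {ℓ' Ls F x y} → JoinEdge Ls F x y → JoinEdge (ℓ' ∷ Ls) F x y
  JoinEdge-there (ℓ , ℓ∈ , rest) = ℓ , there ℓ∈ , rest

  module _ {F : Expr k} where

    join-∋⁺ : ∀ Ls {v ℓ} → F ∋ v ∶ ℓ → join Ls F ∋ v ∶ ℓ
    join-∋⁺ []        p = p
    join-∋⁺ (ℓ' ∷ Ls) p with z ≟ˡ ℓ'
    ... | yes _ = join-∋⁺ Ls p
    ... | no  _ = n-η (join-∋⁺ Ls p)

    join-∋⁻ : ∀ Ls {v ℓ} → join Ls F ∋ v ∶ ℓ → F ∋ v ∶ ℓ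
    join-∋⁻ []        p = p
    join-∋⁻ (ℓ' ∷ Ls) p with z ≟ˡ ℓ' | p
    ... | yes _ | p'     = join-∋⁻ Ls p'
    ... | no  _ | n-η p' = join-∋⁻ Ls p'

    join-wf : ∀ Ls → WF F → WF (join Ls F)
    join-wf []        wfF = wfF
    join-wf (ℓ' ∷ Ls) wfF with z ≟ˡ ℓ'
    ... | yes _ = join-wf Ls wfF
    ... | no  _ = wf-η (join-wf Ls wfF)

    join-edge⁻ : ∀ Ls {x y} → Edge (join Ls F) x y → Edge F x y ⊎ JoinEdge Ls F x y
    join-edge⁻ []        e = inj₁ e
    join-edge⁻ (ℓ' ∷ Ls) e with z ≟ˡ ℓ' | e
    ... | yes _   | e'          = map₂ JoinEdge-there (join-edge⁻ Ls e')
    ... | no  _   | e-η e'      = map₂ JoinEdge-there (join-edge⁻ Ls e')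
    ... | no  z≢ℓ | e-new₁ p q  = inj₂ (ℓ' , here refl , z≢ℓ , inj₁ (join-∋⁻ Ls p , join-∋⁻ Ls q))
    ... | no  z≢ℓ | e-new₂ p q  = inj₂ (ℓ' , here refl , z≢ℓ , inj₂ (join-∋⁻ Ls p , join-∋⁻ Ls q))

    join-edge⁺ : ∀ Ls {x y} → Edge F x y ⊎ JoinEdge Ls F x y → Edge (join Ls F) x y
    join-edge⁺ []        (inj₁ e) = e
    join-edge⁺ (ℓ' ∷ Ls) e with z ≟ˡ ℓ' | e
    ... | yes _   | inj₁ e'                                    = join-edge⁺ Ls (inj₁ e')
    ... | no  _   | inj₁ e'                                    = e-η (join-edge⁺ Ls (inj₁ e'))
    ... | yes z≡ℓ | inj₂ (_ , here refl , z≢ℓ , _)             = contradiction z≡ℓ z≢ℓ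
    ... | yes _   | inj₂ (ℓ , there ℓ∈ , z≢ℓ , ends)          = join-edge⁺ Ls (inj₂ (ℓ , ℓ∈ , z≢ℓ , ends))
    ... | no  _   | inj₂ (_ , here refl , _ , inj₁ (p , q))    = e-new₁ (join-∋⁺ Ls p) (join-∋⁺ Ls q)
    ... | no  _   | inj₂ (_ , here refl , _ , inj₂ (p , q))    = e-new₂ (join-∋⁺ Ls p) (join-∋⁺ Ls q)
    ... | no  _   | inj₂ (ℓ , there ℓ∈ , z≢ℓ , ends)          = e-η (join-edge⁺ Ls (inj₂ (ℓ , ℓ∈ , z≢ℓ , ends)))

-- One step of the marking sequence

module Step (k : ℕ) (w : Word) (S : List Letter) (a : Letter) (a∉S : a ∉ S) (a∈w : a ∈ w)
            (few-blocks : length (blocks (mark (inS S) w)) ≤ k) where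

  S⁺ : List Letter
  S⁺ = S ++ [ a ]

  T : List (Token Word)
  T = tokens (inS S) a w

  labOld labNew : Letter → Lab k
  labOld x = labelOf k (counts (mark (inS S) w) x)
  labNew x = labelOf k (counts (mark (inS S⁺) w) x)

  S⊆S⁺ : x ∈ S → x ∈ S⁺
  S⊆S⁺ = ∈-++⁺ˡ

  a∈S⁺ : a ∈ S⁺
  a∈S⁺ = ∈-++⁺ʳ S (here refl)

  ∈S⁺⇒ : x ∈ S⁺ → x ∈ S ⊎ x ≡ a
  ∈S⁺⇒ x∈S⁺ with ∈-++⁻ S x∈S⁺
  ... | inj₁ x∈S       = inj₁ x∈S
  ... | inj₂ (here x≡a) = inj₂ x≡a

  ∈S⇒≢a : x ∈ S → x ≢ a
  ∈S⇒≢a x∈S refl = a∉S x∈S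

  inS⁺≗inS : ∀ y → y ≢ a → inS S⁺ y ≡ inS S y
  inS⁺≗inS y y≢a = does-⇔ (mk⇔ (fromInj₁ (λ y≡a → contradiction y≡a y≢a) ∘ ∈S⁺⇒) S⊆S⁺) (y ∈? S⁺) (y ∈? S)

  counts-old : ∀ x → counts (mark (inS S) w) x ≡ runs (profile x T)
  counts-old = counts-mark (inS S) a w

  counts-new : x ≢ a → counts (mark (inS S⁺) w) x ≡ runs (markA _+_ 0 (profile x T))
  counts-new {x} x≢a = begin
    counts (mark (inS S⁺) w) x                  ≡⟨ counts-mark (inS S⁺) a w x ⟩
    runs (profile x (tokens (inS S⁺) a w))
      ≡⟨ cong (runs ∘ profile x) (tokens-markA (inS S) (inS S⁺) a inS⁺≗inS (dec-true (a ∈? S⁺) a∈S⁺) w) ⟩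
    runs (profile x (markA _++_ [ a ] T))       ≡⟨ cong runs (profile-markA x≢a T) ⟩
    runs (markA _+_ 0 (profile x T))            ∎
    where open ≡-Reasoning

  π-spell : x ∈ S → π (x ∷ a ∷ []) w ≡ spell x a (profile x T)
  π-spell x∈S = π-pair-spell (inS S) _ a (dec-true (_ ∈? S) x∈S) (dec-false (a ∈? S) a∉S) w

  few-runs : length (runs T) ≤ k
  few-runs = subst (λ bs → length bs ≤ k) (blocks-mark (inS S) a w) few-blocks

  same-profile-label : labOld x ≡ labOld y → labelOf k (runs (profile x T)) ≡ labelOf k (runs (profile y T))
  same-profile-label {x} {y} = subst₂ (λ cx cy → labelOf k cx ≡ labelOf k cy) (counts-old x) (counts-old y)

  labNew-cong : x ∈ S → y ∈ S → labOld x ≡ labOld y → labNew x ≡ labNew y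
  labNew-cong {x} {y} x∈S y∈S eq = begin
    labNew x                                       ≡⟨ cong (labelOf k) (counts-new (∈S⇒≢a x∈S)) ⟩
    labelOf k (runs (markA _+_ 0 (profile x T)))   ≡⟨ same-label-after-markA k T few-runs (same-profile-label eq) ⟩
    labelOf k (runs (markA _+_ 0 (profile y T)))   ≡⟨ cong (labelOf k) (counts-new (∈S⇒≢a y∈S)) ⟨
    labNew y                                       ∎
    where open ≡-Reasoning

  alternate-a-cong : x ∈ S → y ∈ S → labOld x ≡ labOld y → Alternate w x a → Alternate w y a
  alternate-a-cong {x} {y} x∈S y∈S eq (_ , alt) = ∈S⇒≢a y∈S ,
    subst (AlternatingWord y a) (sym (π-spell y∈S))
      (same-alternation k T few-runs (same-profile-label eq) (∈S⇒≢a x∈S ∘ sym)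
        (subst (AlternatingWord x a) (π-spell x∈S) alt))

  labOld-≢-zeros : x ∈ S → x ∈ w → labOld x ≢ zeros
  labOld-≢-zeros {x} x∈S x∈w = subst (_≢ zeros) (cong (labelOf k) (sym (counts-old x)))
    (labelOf-≢-zeros k (profile-nonempty (inS S) a (dec-true (x ∈? S) x∈S) x∈w)
      (subst (_≤ k) (sym (length-runs-profile x T)) few-runs))

  module Construction (E : Expr k) (forE : ExprFor E (AltGraph (π S w)))
                      (labelledE : LabelledBy E (mark (inS S) w)) where

    E-node : ∀ {v} → HasNode E v → v ∈ w × v ∈ S
    E-node {v} p = ∈-π⁻ w (Equivalence.to (proj₁ (proj₂ forE) v) p)

    E-node⁺ : ∀ {v} → v ∈ w → v ∈ S → HasNode E v
    E-node⁺ {v} v∈w v∈S = Equivalence.from (proj₁ (proj₂ forE) v) (∈-π⁺ v∈w v∈S)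

    E-label : ∀ {v ℓ} → E ∋ v ∶ ℓ → ℓ ≡ labOld v
    E-label p = HasLab⇒≡labelOf (labelledE _ _ p)

    E-label-≢-zeros : ∀ {v ℓ} → E ∋ v ∶ ℓ → ℓ ≢ zeros
    E-label-≢-zeros p with v∈w , v∈S ← E-node (_ , p) = subst (_≢ zeros) (sym (E-label p)) (labOld-≢-zeros v∈S v∈w)

    E₀ : Expr k
    E₀ = E ⊕ node zeros a

    E₀-wf : WF E₀
    E₀-wf = wf-⊕ (proj₁ forE) wf-node λ { v p (_ , n-node) → a∉S (proj₂ (E-node p)) }

    E₀-∋ : ∀ {v ℓ} → E₀ ∋ v ∶ ℓ → E ∋ v ∶ ℓ ⊎ (v ≡ a × ℓ ≡ zeros)
    E₀-∋ (n-⊕ˡ p)      = inj₁ p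
    E₀-∋ (n-⊕ʳ n-node) = inj₂ (refl , refl)

    alternates-a? : ∀ x → Dec (Alternate w x a)
    alternates-a? x = alternate? w x a

    opaque
      partners : List (Lab k)
      partners = map labOld (filter alternates-a? (π S w))

      ∈-partners⁻ : ∀ {ℓ} → ℓ ∈ partners → ∃ λ x → x ∈ π S w × Alternate w x a × ℓ ≡ labOld x
      ∈-partners⁻ ℓ∈ with x , x∈ , refl ← ∈-map⁻ labOld ℓ∈ =
        x , proj₁ (∈-filter⁻ alternates-a? {xs = π S w} x∈) , proj₂ (∈-filter⁻ alternates-a? {xs = π S w} x∈) , refl

      ∈-partners⁺ : y ∈ w → y ∈ S → Alternate w y a → labOld y ∈ partners
      ∈-partners⁺ y∈w y∈S alt = ∈-map⁺ labOld (∈-filter⁺ alternates-a? (∈-π⁺ y∈w y∈S) alt)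

    E₁ : Expr k
    E₁ = join zeros partners E₀

    -- The default a is only reached for ℓ = zeros, the label of the new node a.
    witness : Lab k → Letter
    witness ℓ with any? (λ x → labOld x ≟ˡ ℓ) (π S w)
    ... | yes p = proj₁ (find p)
    ... | no  _ = a

    newLabel : Lab k → Lab k
    newLabel ℓ = labNew (witness ℓ)

    newLabel-old : ∀ {v ℓ} → E ∋ v ∶ ℓ → newLabel ℓ ≡ labNew v
    newLabel-old {v} {ℓ} p with v∈w , v∈S ← E-node (_ , p) | any? (λ x → labOld x ≟ˡ ℓ) (π S w)
    ... | yes q with _ , x∈u , eq ← find q = labNew-cong (proj₂ (∈-π⁻ w x∈u)) v∈S (trans eq (E-label p))
    ... | no ¬q = contradiction (lose (∈-π⁺ v∈w v∈S) (sym (E-label p))) ¬q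

    newLabel-zeros : newLabel zeros ≡ labNew a
    newLabel-zeros with any? (λ x → labOld x ≟ˡ zeros) (π S w)
    ... | yes q with _ , x∈u , eq ← find q with x∈w , x∈S ← ∈-π⁻ w x∈u = contradiction eq (labOld-≢-zeros x∈S x∈w)
    ... | no  _ = refl

    E₀-newLabel : ∀ {v ℓ} → E₀ ∋ v ∶ ℓ → newLabel ℓ ≡ labNew v
    E₀-newLabel p with E₀-∋ p
    ... | inj₁ p'            = newLabel-old p'
    ... | inj₂ (refl , refl) = newLabel-zeros

    u⁺ : Word
    u⁺ = π S⁺ w

    Adj⁺ : Letter → Letter → Set
    Adj⁺ = Graph.Adj (AltGraph u⁺)

    a∈u⁺ : a ∈ u⁺
    a∈u⁺ = ∈-π⁺ a∈w a∈S⁺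

    old-letter : x ∈ u⁺ → x ≢ a → x ∈ w × x ∈ S
    old-letter {x} x∈u⁺ x≢a with x∈w , x∈S⁺ ← ∈-π⁻ w x∈u⁺ = x∈w , fromInj₁ (λ x≡a → contradiction x≡a x≢a) (∈S⁺⇒ x∈S⁺)

    E₀-node⇒u⁺ : ∀ {v ℓ} → E ∋ v ∶ ℓ ⊎ (v ≡ a × ℓ ≡ zeros) → v ∈ u⁺
    E₀-node⇒u⁺ (inj₁ p)          = ∈-π⁺ (proj₁ (E-node (_ , p))) (S⊆S⁺ (proj₂ (E-node (_ , p))))
    E₀-node⇒u⁺ (inj₂ (refl , _)) = a∈u⁺

    u⁺⇒E₁-node : ∀ {v} → v ∈ w → v ∈ S ⊎ v ≡ a → HasNode E₁ v
    u⁺⇒E₁-node v∈w (inj₁ v∈S)  =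
      proj₁ (E-node⁺ v∈w v∈S) , join-∋⁺ zeros {F = E₀} partners (n-⊕ˡ (proj₂ (E-node⁺ v∈w v∈S)))
    u⁺⇒E₁-node v∈w (inj₂ refl) = zeros , join-∋⁺ zeros {F = E₀} partners (n-⊕ʳ n-node)

    partner-alternates : ∀ {y ℓ} → E ∋ y ∶ ℓ → ℓ ∈ partners → Alternate w y a
    partner-alternates p ℓ∈ with x , x∈u , alt , refl ← ∈-partners⁻ ℓ∈ =
      alternate-a-cong (proj₂ (∈-π⁻ w x∈u)) (proj₂ (E-node (_ , p))) (E-label p) alt

    zeros-edge : ∀ {x y ℓ} → E₀ ∋ x ∶ zeros → E₀ ∋ y ∶ ℓ → zeros ≢ ℓ → ℓ ∈ partners →
                 x ≡ a × y ∈ w × y ∈ S × Alternate w y a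
    zeros-edge p q z≢ℓ ℓ∈ with E₀-∋ p | E₀-∋ q
    ... | inj₁ p'         | _              = contradiction refl (E-label-≢-zeros p')
    ... | inj₂ _          | inj₂ (_ , ℓ≡z) = contradiction (sym ℓ≡z) z≢ℓ
    ... | inj₂ (refl , _) | inj₁ q'        =
      refl , proj₁ (E-node (_ , q')) , proj₂ (E-node (_ , q')) , partner-alternates q' ℓ∈

    old-edge⇒ : ∀ {x y} → Edge E x y → Adj⁺ x y
    old-edge⇒ {x} {y} e with Equivalence.to (proj₂ (proj₂ forE) x y) e
    ... | x∈u , y∈u , alt with x∈w , x∈S ← ∈-π⁻ w x∈u | y∈w , y∈S ← ∈-π⁻ w y∈u =
      ∈-π⁺ x∈w (S⊆S⁺ x∈S) , ∈-π⁺ y∈w (S⊆S⁺ y∈S) ,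
      Equivalence.from (Alternate-π (S⊆S⁺ x∈S) (S⊆S⁺ y∈S) w) (Equivalence.to (Alternate-π x∈S y∈S w) alt)

    a-edge⇒ : ∀ {y} → y ∈ w → y ∈ S → Alternate w y a → Adj⁺ a y
    a-edge⇒ y∈w y∈S alt = a∈u⁺ , ∈-π⁺ y∈w (S⊆S⁺ y∈S) ,
      Equivalence.from (Alternate-π a∈S⁺ (S⊆S⁺ y∈S) w) (alternate-sym w alt)

    E₁-edge⇒ : ∀ {x y} → Edge E₁ x y → Adj⁺ x y
    E₁-edge⇒ e with join-edge⁻ zeros {F = E₀} partners e
    ... | inj₁ (e-⊕ˡ e') = old-edge⇒ e'
    ... | inj₂ (ℓ , ℓ∈ , z≢ℓ , inj₁ (p , q)) with zeros-edge p q z≢ℓ ℓ∈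
    ...   | refl , y∈w , y∈S , alt = a-edge⇒ y∈w y∈S alt
    E₁-edge⇒ e | inj₂ (ℓ , ℓ∈ , z≢ℓ , inj₂ (p , q)) with zeros-edge q p z≢ℓ ℓ∈
    ...   | refl , x∈w , x∈S , alt with _ , x∈u⁺ , alt' ← a-edge⇒ x∈w x∈S alt = x∈u⁺ , a∈u⁺ , alternate-sym u⁺ alt'

    partner⇐ : ∀ {y} → y ∈ u⁺ → y ≢ a → Alternate u⁺ a y → ∃ λ ℓ → ℓ ∈ partners × zeros ≢ ℓ × E₀ ∋ y ∶ ℓ
    partner⇐ {y} y∈u⁺ y≢a alt with y∈w , y∈S ← old-letter y∈u⁺ y≢a with ℓ , p ← E-node⁺ y∈w y∈S =
      ℓ , subst (_∈ partners) (sym (E-label p)) (∈-partners⁺ y∈w y∈S alt') , E-label-≢-zeros p ∘ sym , n-⊕ˡ p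
      where
      alt' : Alternate w y a
      alt' = alternate-sym w (Equivalence.to (Alternate-π a∈S⁺ (S⊆S⁺ y∈S) w) alt)

    E₁-edge⇐ : ∀ {x y} → Adj⁺ x y → Edge E₁ x y
    E₁-edge⇐ {x} {y} (x∈u⁺ , y∈u⁺ , alt) with x ≟ a | y ≟ a
    ... | yes refl | yes refl = contradiction refl (proj₁ alt)
    ... | yes refl | no  y≢a  with ℓ , ℓ∈ , z≢ℓ , p ← partner⇐ y∈u⁺ y≢a alt =
      join-edge⁺ zeros partners (inj₂ (ℓ , ℓ∈ , z≢ℓ , inj₁ (n-⊕ʳ n-node , p)))
    ... | no  x≢a  | yes refl with ℓ , ℓ∈ , z≢ℓ , p ← partner⇐ x∈u⁺ x≢a (alternate-sym u⁺ alt) =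
      join-edge⁺ zeros partners (inj₂ (ℓ , ℓ∈ , z≢ℓ , inj₂ (p , n-⊕ʳ n-node)))
    ... | no  x≢a  | no  y≢a  with x∈w , x∈S ← old-letter x∈u⁺ x≢a | y∈w , y∈S ← old-letter y∈u⁺ y≢a =
      join-edge⁺ zeros partners (inj₁ (e-⊕ˡ (Equivalence.from (proj₂ (proj₂ forE) x y)
        (∈-π⁺ x∈w x∈S , ∈-π⁺ y∈w y∈S ,
         Equivalence.from (Alternate-π x∈S y∈S w) (Equivalence.to (Alternate-π (S⊆S⁺ x∈S) (S⊆S⁺ y∈S) w) alt)))))

    E₁-relabelled-label : ∀ {v ℓ'} → (∃ λ ℓ → E₁ ∋ v ∶ ℓ × ℓ' ≡ newLabel ℓ) → HasLab k (mark (inS S⁺) w) v ℓ'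
    E₁-relabelled-label {v} (ℓ , q , refl) =
      subst (HasLab k _ v) (sym (E₀-newLabel (join-∋⁻ zeros {F = E₀} partners q))) (HasLab-labelOf k _ v)

    module _ {E' : Expr k} (r : Relabelling E₁ E' (λ ℓ ℓ' → ℓ' ≡ newLabel ℓ)) where
      open Relabelling r

      E'-nodes : ∀ v → HasNode E' v ⇔ (v ∈ u⁺)
      E'-nodes v = mk⇔ (λ p → E₀-node⇒u⁺ (E₀-∋ (join-∋⁻ zeros {F = E₀} partners (proj₂ (node⇒ p)))))
                       (λ v∈u⁺ → node⇐ (u⁺⇒E₁-node (proj₁ (∈-π⁻ w v∈u⁺)) (∈S⁺⇒ (proj₂ (∈-π⁻ w v∈u⁺)))))

      E'-edges : ∀ x y → Edge E' x y ⇔ Adj⁺ x y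
      E'-edges x y = mk⇔ (E₁-edge⇒ ∘ edge⇒) (edge⇐ ∘ E₁-edge⇐)

      E'-for : ExprFor E' (AltGraph u⁺)
      E'-for = wf , E'-nodes , E'-edges

      E'-labels : LabelledBy E' (mark (inS S⁺) w)
      E'-labels v ℓ' p = E₁-relabelled-label (label p)

    relabelled : ∃ λ E' → Relabelling E₁ E' (λ ℓ ℓ' → ℓ' ≡ newLabel ℓ)
    relabelled = relabel newLabel E₁ (join-wf zeros partners E₀-wf)

    result : ∃ λ E' → ExprFor E' (AltGraph u⁺) × LabelledBy E' (mark (inS S⁺) w)
    result = proj₁ relabelled , E'-for (proj₂ relabelled) , E'-labels (proj₂ relabelled)

step : (k : ℕ) (w : Word) (S : List Letter) (a : Letter) → a ∉ S → a ∈ w → length (blocks (mark (inS S) w)) ≤ k →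
       (E : Expr k) → ExprFor E (AltGraph (π S w)) → LabelledBy E (mark (inS S) w) →
       ∃ λ E' → ExprFor E' (AltGraph (π (S ++ [ a ]) w)) × LabelledBy E' (mark (inS (S ++ [ a ])) w)
step k w S a a∉S a∈w few-blocks = Step.Construction.result k w S a a∉S a∈w few-blocks

mainTheorem6 : (k : ℕ) (w : Word) (s : List Letter) → KLocalWitnessed k w s →
    (i : ℕ) → 1 ≤ i → i ≤ length s →
    (E : Expr k) → ExprFor E (AltGraph (π (take (i ∸ 1) s) w)) →
    LabelledBy E (markedAt s (i ∸ 1) w) →
    ∃ λ (E' : Expr k) → ExprFor E' (AltGraph (π (take i s) w)) ×
      LabelledBy E' (markedAt s i w)
mainTheorem6 k w s ((s-unique , s⇔w) , few-blocks) (suc j) _ j<len E forE labelledE =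
  subst (λ S → ∃ λ E' → ExprFor E' (AltGraph (π S w)) × LabelledBy E' (mark (inS S) w)) (sym take-suc≡)
    (step k w (take j s) next next∉ (Equivalence.to (s⇔w next) (∈-lookup i)) (few-blocks j (<⇒≤ j<len))
      E forE labelledE)
  where
  i : Fin (length s)
  i = fromℕ< j<len
  next : Letter
  next = lookup s i
  take-suc≡ : take (suc j) s ≡ take j s ∷ʳ next
  take-suc≡ = subst (λ m → take (suc m) s ≡ take m s ∷ʳ next) (toℕ-fromℕ< j<len) (List.take-suc s i)
  next∉ : next ∉ take j s
  next∉ = Unique-∷ʳ⇒∉ (take j s) (subst Unique take-suc≡ (Unique.take⁺ (suc j) s-unique))
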